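{- Let $n\ge1$ and $\pi=\pi_1\cdots\pi_{3n}\in\mathrm{Av}^\star_{3n}(132)$. Then $\pi_1,\pi_2,\dots,\pi_n$ all belong to pairwise different 3-cycles of $\pi$.
   Context: Permutations are written in one-line notation $\pi=\pi_1\cdots\pi_m$, $\pi_i=\pi(i)$; a permutation avoids $\sigma$ if no subsequence is in the same relative order as $\sigma$. $\mathcal{S}^\star_{3n}$ is the set of permutations of $[3n]$ whose cycle decomposition consists only of 3-cycles, and $\mathrm{Av}^\star_{3n}(132)$ the set of those avoiding 132. -}

module Defs where

open import Data.Nat using (ℕ; _*_)
open import Data.Fin using (Fin; _<_)
open import Data.Fin.Permutation using (Permutation′; _⟨$⟩ʳ_)
open import Data.Product using (∃; _×_; Σ-syntax)
open import Relation.Binary.PropositionalEquality using (_≡_; _≢_)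
open import Relation.Nullary using (¬_)

-- Positions/values 1..m are represented by Fin m (0..m-1); order is preserved.

app : ∀ {m} → Permutation′ m → Fin m → Fin m
app π i = π ⟨$⟩ʳ i

OnlyThreeCycles : ∀ {m} → Permutation′ m → Set
OnlyThreeCycles {m} π = ∀ (i : Fin m) → (app π i ≢ i) × (app π (app π (app π i)) ≡ i)

Contains132 : ∀ {m} → Permutation′ m → Set
Contains132 {m} π = Σ[ a ∈ Fin m ] Σ[ b ∈ Fin m ] Σ[ c ∈ Fin m ]
  (a < b) × (b < c) × (app π a < app π c) × (app π c < app π b)

Avoids132 : ∀ {m} → Permutation′ m → Set
Avoids132 π = ¬ Contains132 π

iter : ∀ {m} → Permutation′ m → ℕ → Fin m → Fin m
iter π ℕ.zero x = x
iter π (ℕ.suc k) x = app π (iter π k x)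

SameCycle : ∀ {m} → Permutation′ m → Fin m → Fin m → Set
SameCycle π x y = ∃ λ k → iter π k x ≡ y

-- It suffices that no position i < n has π i < n. Suppose it does, and call y
-- northeast when i < y and π i < π y. By 132-avoidance π is increasing on the
-- northeast points, so no 3-cycle lies entirely in the northeast. Give every other
-- point weight 1, plus 1 more if the rest of its cycle is northeast: then every
-- cycle weighs at least 2 and the total weight is at least 2n. Such a "lonely"
-- point y must have i < π y < π i or π i < y ≤ i, so counting the weight by
-- positions and values bounds it by (i + 1 + (π i ∸ (i + 1))) + (π i + (i ∸ π i)) < 2n.
module Submission where

open import Defs
open import Data.Nat using (ℕ; _*_; _≥_)
open import Data.Fin using (Fin; toℕ)
open import Data.Fin.Permutation using (Permutation′)
open import Relation.Binary.PropositionalEquality using (_≢_)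
open import Relation.Nullary using (¬_)

open import Data.Nat
  using (zero; suc; _+_; _∸_; _≤_; _<_; z≤n; s≤s; s≤s⁻¹; _≤?_; _<?_)
open import Data.Nat.Properties
open import Data.Nat.Solver using (module +-*-Solver)
import Data.Fin as Fin
import Data.Fin.Properties as Fin
open import Data.Fin.Permutation using (_⟨$⟩ˡ_; inverseˡ)
open import Data.Product using (_×_; _,_; proj₁; proj₂)
open import Data.Sum using (_⊎_; inj₁; inj₂)
open import Data.Empty using (⊥; ⊥-elim)
open import Relation.Nullary using (Dec; yes; no)
open import Relation.Nullary.Decidable using (_×-dec_; ¬?)
open import Relation.Binary using (tri<; tri≈; tri>)
open import Relation.Binary.PropositionalEquality
  using (_≡_; refl; sym; trans; cong; cong₂; subst; module ≡-Reasoning)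
open import Algebra.Properties.CommutativeMonoid.Sum +-0-commutativeMonoid
  using (sum; sum-permute; ∑-distrib-+)
open import Algebra.Properties.CommutativeSemigroup +-commutativeSemigroup
  using (interchange)

indicator : {P : Set} → Dec P → ℕ
indicator (yes _) = 1
indicator (no _)  = 0

indicator-yes : {P : Set} (p : Dec P) → P → indicator p ≡ 1
indicator-yes (yes _) _ = refl
indicator-yes (no ¬p) p = ⊥-elim (¬p p)

indicator-no : {P : Set} (p : Dec P) → ¬ P → indicator p ≡ 0
indicator-no (yes p) ¬p = ⊥-elim (¬p p)
indicator-no (no _)  _  = refl

indicator≤1 : {P : Set} (p : Dec P) → indicator p ≤ 1
indicator≤1 (yes _) = ≤-refl
indicator≤1 (no _)  = z≤n

indicator-mono : {P Q : Set} (p : Dec P) (q : Dec Q) → (P → Q) → indicator p ≤ indicator q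
indicator-mono (yes x) q P⇒Q = ≤-reflexive (sym (indicator-yes q (P⇒Q x)))
indicator-mono (no _)  q P⇒Q = z≤n

indicator-≤-+ : {P Q R : Set} (p : Dec P) (q : Dec Q) (r : Dec R) →
                (P → Q ⊎ R) → indicator p ≤ indicator q + indicator r
indicator-≤-+ (no _)  q r P⇒Q⊎R = z≤n
indicator-≤-+ (yes x) q r P⇒Q⊎R with P⇒Q⊎R x
... | inj₁ y = ≤-trans (≤-reflexive (sym (indicator-yes q y))) (m≤m+n _ _)
... | inj₂ z = ≤-trans (≤-reflexive (sym (indicator-yes r z))) (m≤n+m _ _)

sum-mono-≤ : ∀ {N} {f g : Fin N → ℕ} → (∀ y → f y ≤ g y) → sum f ≤ sum g
sum-mono-≤ {zero}  f≤g = z≤n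
sum-mono-≤ {suc N} f≤g = +-mono-≤ (f≤g Fin.zero) (sum-mono-≤ (λ y → f≤g (Fin.suc y)))

sum-const : ∀ N c → sum {N} (λ _ → c) ≡ N * c
sum-const zero    c = refl
sum-const (suc N) c = cong (c +_) (sum-const N c)

Between : ℕ → ℕ → ℕ → Set
Between m k t = m ≤ t × t < k

between? : ∀ m k t → Dec (Between m k t)
between? m k t = (m ≤? t) ×-dec (t <? k)

χ-between : ℕ → ℕ → ℕ → ℕ
χ-between m k t = indicator (between? m k t)

count-between : ∀ N m k → sum {N} (λ y → χ-between m k (toℕ y)) ≤ k ∸ m
count-shifted : ∀ N m k m′ k′ → (∀ {t} → Between m k (suc t) → Between m′ k′ t) →
                sum {N} (λ y → χ-between m k (suc (toℕ y))) ≤ k′ ∸ m′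

count-between zero    m       k       = z≤n
count-between (suc N) zero    zero    =
  +-mono-≤ (≤-reflexive (indicator-no (between? 0 0 0) λ { (_ , ()) }))
           (count-shifted N 0 0 0 0 λ { (_ , ()) })
count-between (suc N) zero    (suc k) =
  +-mono-≤ (indicator≤1 (between? 0 (suc k) 0))
           (count-shifted N 0 (suc k) 0 k λ (_ , t<k) → z≤n , s≤s⁻¹ t<k)
count-between (suc N) (suc m) zero    =
  +-mono-≤ (≤-reflexive (indicator-no (between? (suc m) 0 0) λ { (_ , ()) }))
           (count-shifted N (suc m) 0 0 0 λ { (_ , ()) })
count-between (suc N) (suc m) (suc k) =
  +-mono-≤ (≤-reflexive (indicator-no (between? (suc m) (suc k) 0) λ { (() , _) }))
           (count-shifted N (suc m) (suc k) m k λ (m≤t , t<k) → s≤s⁻¹ m≤t , s≤s⁻¹ t<k)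

count-shifted N m k m′ k′ shift =
  ≤-trans (sum-mono-≤ {N} λ y →
             indicator-mono (between? m k (suc (toℕ y))) (between? m′ k′ (toℕ y)) shift)
          (count-between N m′ k′)

m+[n∸m]≤o : ∀ {m n o} → m ≤ o → n ≤ o → m + (n ∸ m) ≤ o
m+[n∸m]≤o {m} {n} m≤o n≤o with ≤-total m n
... | inj₁ m≤n = ≤-trans (≤-reflexive (m+[n∸m]≡n m≤n)) n≤o
... | inj₂ n≤m = ≤-trans (≤-reflexive (trans (cong (m +_) (m≤n⇒m∸n≡0 n≤m)) (+-identityʳ m))) m≤o

module _ {N : ℕ} (π : Permutation′ N) where

  app-injective : ∀ {x y} → app π x ≡ app π y → x ≡ y
  app-injective eq = trans (sym (inverseˡ π)) (trans (cong (π ⟨$⟩ˡ_) eq) (inverseˡ π))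

  sum-∘-app : (f : Fin N → ℕ) → sum (λ y → f (app π y)) ≡ sum f
  sum-∘-app f = sym (sum-permute f π)

  sum-orbit : (f : Fin N → ℕ) →
              sum (λ y → f y + f (app π y) + f (app π (app π y))) ≡ 3 * sum f
  sum-orbit f = begin
    sum (λ y → f y + f (app π y) + f (app π (app π y)))
      ≡⟨ ∑-distrib-+ (λ y → f y + f (app π y)) (λ y → f (app π (app π y))) ⟩
    sum (λ y → f y + f (app π y)) + sum (λ y → f (app π (app π y)))
      ≡⟨ cong₂ _+_ (∑-distrib-+ f (λ y → f (app π y)))
                   (trans (sum-∘-app (λ y → f (app π y))) (sum-∘-app f)) ⟩
    sum f + sum (λ y → f (app π y)) + sum f
      ≡⟨ cong (λ s → sum f + s + sum f) (sum-∘-app f) ⟩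
    sum f + sum f + sum f
      ≡⟨ solve 1 (λ s → s :+ s :+ s := con 3 :* s) refl (sum f) ⟩
    3 * sum f ∎
    where
    open ≡-Reasoning
    open +-*-Solver

  same-cycle⇒orbit : (∀ x → app π (app π (app π x)) ≡ x) → ∀ {x y} →
                     SameCycle π x y → x ≡ y ⊎ app π x ≡ y ⊎ app π (app π x) ≡ y
  same-cycle⇒orbit cube (k , πᵏx≡y) = go k πᵏx≡y
    where
    go : ∀ k {x y} → iter π k x ≡ y → x ≡ y ⊎ app π x ≡ y ⊎ app π (app π x) ≡ y
    go zero                x≡y     = inj₁ x≡y
    go (suc zero)          πx≡y    = inj₂ (inj₁ πx≡y)
    go (suc (suc zero))    π²x≡y   = inj₂ (inj₂ π²x≡y)
    go (suc (suc (suc k))) {x} πᵏ⁺³x≡y = go k (trans (sym (cube (iter π k x))) πᵏ⁺³x≡y)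

module NortheastWeight {N : ℕ} (π : Permutation′ N) (cycles : OnlyThreeCycles π)
                 (avoids : Avoids132 π) (i : Fin N) where

  a b : ℕ
  a = toℕ i
  b = toℕ (app π i)

  cube : ∀ y → app π (app π (app π y)) ≡ y
  cube y = proj₂ (cycles y)

  Northeast : Fin N → Set
  Northeast y = i Fin.< y × app π i Fin.< app π y

  northeast? : ∀ y → Dec (Northeast y)
  northeast? y = (i Fin.<? y) ×-dec (app π i Fin.<? app π y)

  northeast-increasing : ∀ {x y} → Northeast x → Northeast y → x Fin.< y → app π x Fin.< app π y
  northeast-increasing {x} {y} (i<x , _) (_ , πi<πy) x<y with Fin.<-cmp (app π x) (app π y)
  ... | tri< πx<πy _ _ = πx<πy
  ... | tri≈ _ πx≡πy _ = ⊥-elim (Fin.<-irrefl (app-injective π πx≡πy) x<y)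
  ... | tri> _ _ πy<πx = ⊥-elim (avoids (i , x , y , i<x , x<y , πi<πy , πy<πx))

  -- π would increase along the whole cycle and so return above or below its start.
  orbit-not-northeast : ∀ y → Northeast y → Northeast (app π y) → Northeast (app π (app π y)) → ⊥
  orbit-not-northeast y ne₀ ne₁ ne₂ with Fin.<-cmp y (app π y)
  ... | tri< y<πy _ _ =
    Fin.<-irrefl refl (Fin.<-trans y<πy (Fin.<-trans πy<π²y π²y<y))
    where
    πy<π²y : app π y Fin.< app π (app π y)
    πy<π²y = northeast-increasing ne₀ ne₁ y<πy
    π²y<y : app π (app π y) Fin.< y
    π²y<y = subst (app π (app π y) Fin.<_) (cube y) (northeast-increasing ne₁ ne₂ πy<π²y)
  ... | tri≈ _ y≡πy _ = proj₁ (cycles y) (sym y≡πy)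
  ... | tri> _ _ πy<y =
    Fin.<-irrefl refl (Fin.<-trans π²y<πy (Fin.<-trans πy<y y<π²y))
    where
    π²y<πy : app π (app π y) Fin.< app π y
    π²y<πy = northeast-increasing ne₁ ne₀ πy<y
    y<π²y : y Fin.< app π (app π y)
    y<π²y = subst (Fin._< app π (app π y)) (cube y) (northeast-increasing ne₂ ne₁ π²y<πy)

  below-value : ∀ {y} → ¬ Northeast y → i Fin.< y → app π y Fin.< app π i
  below-value {y} ¬ne i<y with Fin.<-cmp (app π y) (app π i)
  ... | tri< πy<πi _ _ = πy<πi
  ... | tri≈ _ πy≡πi _ = ⊥-elim (Fin.<-irrefl (sym (app-injective π πy≡πi)) i<y)
  ... | tri> _ _ πi<πy = ⊥-elim (¬ne (i<y , πi<πy))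

  Lonely : Fin N → Set
  Lonely y = ¬ Northeast y × Northeast (app π y) × Northeast (app π (app π y))

  lonely? : ∀ y → Dec (Lonely y)
  lonely? y = ¬? (northeast? y) ×-dec northeast? (app π y) ×-dec northeast? (app π (app π y))

  weight : Fin N → ℕ
  weight y = indicator (¬? (northeast? y)) + indicator (lonely? y)

  weight-outside : ∀ {y} → ¬ Northeast y → 1 ≤ weight y
  weight-outside {y} ¬ne =
    ≤-trans (≤-reflexive (sym (indicator-yes (¬? (northeast? y)) ¬ne))) (m≤m+n _ _)

  weight-lonely : ∀ {y} → Lonely y → 2 ≤ weight y
  weight-lonely {y} lonely =
    ≤-reflexive (sym (cong₂ _+_ (indicator-yes (¬? (northeast? y)) (proj₁ lonely))
                                (indicator-yes (lonely? y) lonely)))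

  orbit-weight : ∀ y → 2 ≤ weight y + weight (app π y) + weight (app π (app π y))
  orbit-weight y = by-cases (northeast? y) (northeast? (app π y)) (northeast? (app π (app π y)))
    where
    w₀ w₁ w₂ : ℕ
    w₀ = weight y
    w₁ = weight (app π y)
    w₂ = weight (app π (app π y))
    by-cases : Dec (Northeast y) → Dec (Northeast (app π y)) → Dec (Northeast (app π (app π y))) →
               2 ≤ w₀ + w₁ + w₂
    by-cases (no ¬ne₀) (no ¬ne₁) _         =
      +-mono-≤ (+-mono-≤ (weight-outside ¬ne₀) (weight-outside ¬ne₁)) (z≤n {w₂})
    by-cases (no ¬ne₀) (yes _)   (no ¬ne₂) =
      +-mono-≤ (+-mono-≤ (weight-outside ¬ne₀) (z≤n {w₁})) (weight-outside ¬ne₂)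
    by-cases (no ¬ne₀) (yes ne₁) (yes ne₂) =
      +-mono-≤ (+-mono-≤ (weight-lonely (¬ne₀ , ne₁ , ne₂)) (z≤n {w₁})) (z≤n {w₂})
    by-cases (yes _)   (no ¬ne₁) (no ¬ne₂) =
      +-mono-≤ (+-mono-≤ (z≤n {w₀}) (weight-outside ¬ne₁)) (weight-outside ¬ne₂)
    by-cases (yes ne₀) (no ¬ne₁) (yes ne₂) =
      +-mono-≤ (+-mono-≤ (z≤n {w₀}) (weight-lonely (¬ne₁ , ne₂ , subst Northeast (sym (cube y)) ne₀))) (z≤n {w₂})
    by-cases (yes ne₀) (yes ne₁) (no ¬ne₂) =
      +-mono-≤ (z≤n {w₀ + w₁}) (weight-lonely (¬ne₂ , subst Northeast (sym (cube y)) ne₀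
                                                   , subst Northeast (sym (cong (app π) (cube y))) ne₁))
    by-cases (yes ne₀) (yes ne₁) (yes ne₂) = ⊥-elim (orbit-not-northeast y ne₀ ne₁ ne₂)

  weight-sum-lower : N * 2 ≤ 3 * sum weight
  weight-sum-lower = begin
    N * 2                                                               ≡⟨ sum-const N 2 ⟨
    sum {N} (λ _ → 2)                                                   ≤⟨ sum-mono-≤ orbit-weight ⟩
    sum (λ y → weight y + weight (app π y) + weight (app π (app π y)))  ≡⟨ sum-orbit π weight ⟩
    3 * sum weight                                                      ∎
    where open ≤-Reasoning

  outside-bound : ∀ {y} → ¬ Northeast y →
                  Between 0 (suc a) (toℕ y) ⊎ Between 0 b (toℕ (app π y))
  outside-bound {y} ¬ne with toℕ y ≤? a
  ... | yes y≤a = inj₁ (z≤n , s≤s y≤a)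
  ... | no  y≰a = inj₂ (z≤n , below-value ¬ne (≰⇒> y≰a))

  lonely-bound : ∀ {y} → Lonely y →
                 Between (suc a) b (toℕ (app π y)) ⊎ Between (suc b) (suc a) (toℕ y)
  lonely-bound {y} (¬ne₀ , (i<πy , _) , (_ , πi<π³y)) with toℕ y ≤? a
  ... | yes y≤a = inj₂ (subst (app π i Fin.<_) (cube y) πi<π³y , s≤s y≤a)
  ... | no  y≰a = inj₁ (i<πy , below-value ¬ne₀ (≰⇒> y≰a))

  weight-bound : ∀ y → weight y ≤ (χ-between 0 (suc a) (toℕ y) + χ-between 0 b (toℕ (app π y)))
                                  + (χ-between (suc a) b (toℕ (app π y)) + χ-between (suc b) (suc a) (toℕ y))
  weight-bound y =
    +-mono-≤ (indicator-≤-+ (¬? (northeast? y)) (between? _ _ _) (between? _ _ _) outside-bound)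
             (indicator-≤-+ (lonely? y) (between? _ _ _) (between? _ _ _) lonely-bound)

  weight-sum-upper : sum weight ≤ (suc a + (b ∸ suc a)) + (b + (a ∸ b))
  weight-sum-upper = begin
    sum weight
      ≤⟨ sum-mono-≤ weight-bound ⟩
    sum (λ y → (A y + B y) + (C y + D y))
      ≡⟨ trans (∑-distrib-+ (λ y → A y + B y) (λ y → C y + D y))
               (cong₂ _+_ (∑-distrib-+ A B) (∑-distrib-+ C D)) ⟩
    (sum A + sum B) + (sum C + sum D)
      ≤⟨ +-mono-≤ (+-mono-≤ (count-between N 0 (suc a)) (by-values 0 b))
                  (+-mono-≤ (by-values (suc a) b) (count-between N (suc b) (suc a))) ⟩
    (suc a + b) + ((b ∸ suc a) + (a ∸ b))
      ≡⟨ interchange (suc a) b (b ∸ suc a) (a ∸ b) ⟩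
    (suc a + (b ∸ suc a)) + (b + (a ∸ b)) ∎
    where
    open ≤-Reasoning
    A B C D : Fin N → ℕ
    A y = χ-between 0 (suc a) (toℕ y)
    B y = χ-between 0 b (toℕ (app π y))
    C y = χ-between (suc a) b (toℕ (app π y))
    D y = χ-between (suc b) (suc a) (toℕ y)
    by-values : ∀ m k → sum (λ y → χ-between m k (toℕ (app π y))) ≤ k ∸ m
    by-values m k =
      ≤-trans (≤-reflexive (sum-∘-app π (λ y → χ-between m k (toℕ y)))) (count-between N m k)

first-third-maps-out : ∀ n (π : Permutation′ (3 * n)) → OnlyThreeCycles π → Avoids132 π →
                       ∀ y → toℕ y < n → toℕ (app π y) < n → ⊥
first-third-maps-out n π cycles avoids y y<n πy<n = <⇒≱ weight<n+n n+n≤weight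
  where
  open NortheastWeight π cycles avoids y
  weight<n+n : sum weight < n + n
  weight<n+n =
    ≤-<-trans weight-sum-upper (+-mono-≤-< (m+[n∸m]≤o y<n (<⇒≤ πy<n)) (m+[n∸m]≤o πy<n y<n))
  n+n≤weight : n + n ≤ sum weight
  n+n≤weight = *-cancelˡ-≤ 3 (≤-trans (≤-reflexive 3[n+n]≡3n*2) weight-sum-lower)
    where
    open +-*-Solver
    3[n+n]≡3n*2 : 3 * (n + n) ≡ 3 * n * 2
    3[n+n]≡3n*2 = solve 1 (λ n → con 3 :* (n :+ n) := con 3 :* n :* con 2) refl n

lemma3p11 : (n : ℕ) → n ≥ 1 → (π : Permutation′ (3 * n))
    → OnlyThreeCycles π → Avoids132 π
    → (i j : Fin (3 * n)) → toℕ i Data.Nat.< n → toℕ j Data.Nat.< n → i ≢ j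
    → ¬ SameCycle π (app π i) (app π j)
lemma3p11 n _ π cycles avoids i j i<n j<n i≢j sameCycle
  with same-cycle⇒orbit π (λ x → proj₂ (cycles x)) sameCycle
... | inj₁ πi≡πj          = i≢j (app-injective π πi≡πj)
... | inj₂ (inj₁ π²i≡πj) = first-third-maps-out n π cycles avoids i i<n
                              (subst (λ z → toℕ z < n) (sym (app-injective π π²i≡πj)) j<n)
... | inj₂ (inj₂ π³i≡πj) = first-third-maps-out n π cycles avoids j j<n
                              (subst (λ z → toℕ z < n) i≡πj i<n)
  where
  i≡πj : i ≡ app π j
  i≡πj = trans (sym (proj₂ (cycles i))) (cong (app π) (app-injective π π³i≡πj))
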